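{- With $G(x,y,p)$ as in the context, \[ G(x,y,p)=\sum_{n\ge0}(pxy)^{n}\sum_{\mu\in\mathcal D_{n+1}}p^{D(\mu)}\,y^{\,n+1-\mathfrak p(\mu)},\qquad D(\mu):=\mathfrak p(\mu)+\mathrm{Area}(\mu)-(n+1). \]
   Context: **Heaps.** A heap (Viennot) is a finite poset with a labelling by pieces such that concurrent pieces are comparable and covering pieces are concurrent, up to isomorphism. The pieces are monomers $[1,1]$ (only at abscissa $1$) and dimers $[c,c+1]$ with $c\ge1$, concurrent iff they intersect. For a heap $H$ with $N(d)$ dimers and $N(m)$ monomers, set $v(H)=x^{N(d)+N(m)}y^{2N(d)+N(m)}p^{\sum(\text{left abscissae of pieces})}$. Define $G(x,y,p)=\sum_H v(H)$, summed over the heaps with a unique maximal piece of left abscissa $1$ plus the empty heap, which contributes $1$. **Dyck paths.** $\mathcal D_m$ is the set of Dyck paths of semilength $m$: words in $\{U,D\}$ with $m$ letters of each kind such that every prefix has at least as many $U$'s as $D$'s. $\mathfrak p(\mu)$ is the number of prime factors of $\mu$, i.e. the number of returns to level $0$. For $\mu\in\mathcal D_m$ drawn with $U=(0,1)$ and $D=(1,0)$ as a path from $(0,0)$ to $(m,m)$, $\mathrm{Area}(\mu)$ is the number of unit squares lying between $\mu$ and the staircase path $(UD)^m$. -}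

module Defs where

open import Data.Nat using (ℕ; zero; suc; _+_; _*_; _∸_; _≡ᵇ_)
open import Data.Integer as ℤ using (ℤ; +_)
open import Data.Bool using (Bool; true; false; T; if_then_else_; _∧_)
open import Data.Fin using (Fin)
open import Data.Nat.ListAction using (sum)
open import Data.List using (List; []; _∷_; map; allFin; filterᵇ; concatMap; length)
open import Data.List.Membership.Propositional using (_∈_)
open import Data.Product using (Σ; _×_; _,_)
open import Data.Sum using (_⊎_)
open import Relation.Binary.PropositionalEquality using (_≡_)
open import Relation.Nullary using (¬_)
open import Function.Bundles using (_↔_; Inverse)

-- Pieces
-- mono      : the monomer [1,1]
-- dimer c   : the dimer [c+1, c+2]   (so every dimer [c',c'+1], c' ≥ 1,
--             is  dimer (c' - 1); left abscissa c' = suc c)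

data Piece : Set where
  mono  : Piece
  dimer : ℕ → Piece

cells : Piece → List ℕ
cells mono      = 1 ∷ []
cells (dimer c) = suc c ∷ suc (suc c) ∷ []

leftAbs : Piece → ℕ
leftAbs mono      = 1
leftAbs (dimer c) = suc c

Concurrent : Piece → Piece → Set
Concurrent P Q = Σ ℕ λ i → i ∈ cells P × i ∈ cells Q

isDimer isMono : Piece → Bool
isDimer mono      = false
isDimer (dimer _) = true
isMono  mono      = true
isMono  (dimer _) = false

record Heap (k : ℕ) : Set where
  field
    lab : Fin k → Piece
    le  : Fin k → Fin k → Bool

  _≼_ : Fin k → Fin k → Set
  i ≼ j = T (le i j)

  _≺_ : Fin k → Fin k → Set
  i ≺ j = i ≼ j × ¬ (i ≡ j)

  _⋖_ : Fin k → Fin k → Set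
  i ⋖ j = i ≺ j × (∀ m → ¬ (i ≺ m × m ≺ j))

  IsMaximal : Fin k → Set
  IsMaximal i = ∀ j → i ≼ j → j ≡ i

open Heap public using (lab; le; IsMaximal)

IsHeap : ∀ {k} → Heap k → Set
IsHeap {k} H =
  (∀ i → i ≼ i) ×
  (∀ i j → i ≼ j → j ≼ i → i ≡ j) ×
  (∀ i j l → i ≼ j → j ≼ l → i ≼ l) ×
  (∀ i j → Concurrent (lab H i) (lab H j) → (i ≼ j) ⊎ (j ≼ i)) ×
  (∀ i j → i ⋖ j → Concurrent (lab H i) (lab H j))
  where
  open Heap H using (_≼_; _⋖_)

HasUniqueMaxAt1 : ∀ {k} → Heap k → Set
HasUniqueMaxAt1 {k} H =
  Σ (Fin k) λ m → IsMaximal H m × leftAbs (lab H m) ≡ 1 × (∀ j → IsMaximal H j → j ≡ m)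

-- the heaps summed in G: pyramids with maximal piece at abscissa 1,
-- plus the empty heap
Admissible : ∀ {k} → Heap k → Set
Admissible {k} H = IsHeap H × ((k ≡ 0) ⊎ HasUniqueMaxAt1 H)

HeapIso : ∀ {k} → Heap k → Heap k → Set
HeapIso {k} H H' =
  Σ (Fin k ↔ Fin k) λ σ →
    (∀ i → lab H' (Inverse.to σ i) ≡ lab H i) ×
    (∀ i j → le H' (Inverse.to σ i) (Inverse.to σ j) ≡ le H i j)

countᵇ : ∀ {A : Set} → (A → Bool) → List A → ℕ
countᵇ p xs = length (filterᵇ p xs)

-- weight v(H) = x^{N(d)+N(m)} y^{2N(d)+N(m)} p^{Σ left abscissae},
-- recorded as the exponent triple (x-exp, y-exp, p-exp)
heapWeight : ∀ {k} → Heap k → ℤ × ℤ × ℤ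
heapWeight {k} H =
  let ps = map (lab H) (allFin k)
      Nd = countᵇ isDimer ps
      Nm = countᵇ isMono ps
  in (+ (Nd + Nm)) , (+ (2 * Nd + Nm)) , (+ sum (map leftAbs ps))

data Step : Set where
  U D : Step

words : ℕ → List (List Step)
words zero    = [] ∷ []
words (suc l) = concatMap (λ w → (U ∷ w) ∷ (D ∷ w) ∷ []) (words l)

-- every prefix has #U ≥ #D and the word ends at level 0
-- (h = current level = #U - #D of the prefix read so far)
dyckFrom : ℕ → List Step → Bool
dyckFrom zero    []      = true
dyckFrom (suc h) []      = false
dyckFrom h       (U ∷ w) = dyckFrom (suc h) w
dyckFrom zero    (D ∷ w) = false
dyckFrom (suc h) (D ∷ w) = dyckFrom h w

isDyck : List Step → Bool
isDyck = dyckFrom 0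

DyckPaths : ℕ → List (List Step)
DyckPaths m = filterᵇ isDyck (words (2 * m))

-- number of returns to level 0 (= number of prime factors)
returnsFrom : ℕ → List Step → ℕ
returnsFrom h       []      = 0
returnsFrom h       (U ∷ w) = returnsFrom (suc h) w
returnsFrom zero    (D ∷ w) = returnsFrom zero w
returnsFrom (suc h) (D ∷ w) = (if h ≡ᵇ 0 then 1 else 0) + returnsFrom h w

primeFactors : List Step → ℕ
primeFactors = returnsFrom 0

-- Area: with U = (0,1), D = (1,0), the (i+1)-th D step is the horizontal
-- segment [i,i+1] at height u_i = #U's before it; the staircase (UD)^m has
-- it at height i+1.  So column i contributes the u_i - (i+1) unit squares
-- [i,i+1]×[j,j+1] with i+1 ≤ j < u_i lying between μ and the staircase.
heightsOfD : ℕ → List Step → List ℕ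
heightsOfD u []      = []
heightsOfD u (U ∷ w) = heightsOfD (suc u) w
heightsOfD u (D ∷ w) = u ∷ heightsOfD u w

columnsArea : ℕ → List ℕ → ℕ
columnsArea i []       = 0
columnsArea i (u ∷ us) = (u ∸ suc i) + columnsArea (suc i) us

Area : List Step → ℕ
Area μ = columnsArea 0 (heightsOfD 0 μ)

Dstat : ℕ → List Step → ℤ
Dstat n μ = (+ primeFactors μ ℤ.+ + Area μ) ℤ.- + suc n

-- exponent triple of (pxy)^n p^{D(μ)} y^{n+1-𝔭(μ)}
dyckWeight : ℕ → List Step → ℤ × ℤ × ℤ
dyckWeight n μ =
  (+ n) , (+ n ℤ.+ (+ suc n ℤ.- + primeFactors μ)) , (+ n ℤ.+ Dstat n μ)

{-# OPTIONS --safe #-}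
-- Code the monomer by 0 and a dimer by its left abscissa; two pieces are then
-- concurrent iff their codes differ by at most one.  Reading a heap top-down in
-- its greedy normal form (repeatedly remove a maximal piece of largest code)
-- gives a code sequence that rises by at most one at each step and, for the
-- heaps summed in G, starts at 0 or 1.  Along any linear extension the code
-- sequence determines the heap, and the greedy normal form is the only linear
-- extension whose codes rise this slowly, so its sequence is a complete
-- isomorphism invariant.  The sequences obtained are exactly the heights of the
-- up steps after the first of the Dyck paths of semilength n + 1.  Monomers are
-- then the up steps at height 0, one fewer than the returns, and the heights of
-- all up steps add up to the area, which matches the weights.

module Submission where

open import Defs
open import Data.Bool using (true; false; T)
open import Data.Empty using (⊥; ⊥-elim)
open import Data.Fin as Fin using (Fin; zero; suc; toℕ; fromℕ<; punchIn; punchOut)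
open import Data.Fin.Induction using (po-wellFounded; po-noetherian) renaming (<-wellFounded to <ᶠ-wellFounded)
open import Data.Fin.Permutation as Perm using (Permutation′; _⟨$⟩ʳ_; _⟨$⟩ˡ_; inverseˡ; inverseʳ; _∘ₚ_; insert-punchIn)
open import Data.Fin.Properties
  using (toℕ-injective; toℕ<n; toℕ-fromℕ<; any?; all?; ¬∀⟶∃¬; punchIn-injective; punchInᵢ≢i; punchIn-punchOut)
open import Data.Integer as ℤ using (ℤ; +_)
import Data.Integer.Tactic.RingSolver as ℤ-Solver
open import Data.List using (List; []; _∷_; map; tabulate; length; filter; allFin; replicate; _++_; concatMap; drop)
open import Data.List.Extrema.Nat using (argmax; argmax-all; f[xs]≤f[argmax])
open import Data.List.Membership.Propositional using (_∈_; lose)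
open import Data.List.Membership.Propositional.Properties using (∈-filter⁺; ∈-filter⁻; ∈-allFin; ∈-concatMap⁺)
open import Data.List.Properties using (tabulate-cong; length-tabulate; ∷-injectiveʳ; map-tabulate; map-∘; map-cong-local)
open import Data.List.Relation.Binary.Permutation.Propositional using (_↭_; ↭-reflexive)
open import Data.List.Relation.Unary.All as All using (All; []; _∷_)
open import Data.List.Relation.Unary.All.Properties using (all-filter; concat⁺) renaming (map⁺ to All-map⁺)
open import Data.List.Relation.Unary.AllPairs using (AllPairs; []; _∷_)
open import Data.List.Relation.Unary.AllPairs.Properties using () renaming (map⁺ to AllPairs-map⁺)
open import Data.List.Relation.Unary.Any as Any using (Any; here; there)
open import Data.List.Relation.Unary.Any.Properties using () renaming (map⁺ to Any-map⁺)
open import Data.List.Relation.Unary.Unique.Propositional using (Unique)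
import Data.List.Relation.Unary.Unique.Propositional.Properties as Unique
open import Data.Nat using (ℕ; zero; suc; _+_; _*_; _∸_; _≤_; _<_; _⊓_; z≤n; s≤s; _≟_; _≤?_; pred; _≡ᵇ_)
open import Data.Nat.Induction using (<-rec)
open import Data.Nat.ListAction using (sum)
open import Data.Nat.Properties
open import Data.Nat.Tactic.RingSolver using (solve-∀)
open import Data.Product using (Σ; ∃; _×_; _,_; proj₁; proj₂)
open import Data.Sum using (_⊎_; inj₁; inj₂)
open import Function using (flip)
open import Induction.WellFounded using (Acc; acc)
open import Relation.Binary using (IsPartialOrder; tri<; tri≈; tri>)
open import Relation.Binary.PropositionalEquality
open import Relation.Nullary using (¬_; Dec; yes; no; contradiction)
open import Relation.Nullary.Decidable using (_×-dec_; _→-dec_; ¬?; T?; map′; toWitness; fromWitness; isYes)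

code : Piece → ℕ
code mono      = 0
code (dimer c) = suc c

pieceOf : ℕ → Piece
pieceOf zero    = mono
pieceOf (suc c) = dimer c

code-pieceOf : ∀ c → code (pieceOf c) ≡ c
code-pieceOf zero    = refl
code-pieceOf (suc c) = refl

pieceOf-code : ∀ P → pieceOf (code P) ≡ P
pieceOf-code mono      = refl
pieceOf-code (dimer c) = refl

leftAbs-pieceOf : ∀ {c} → c ≤ 1 → leftAbs (pieceOf c) ≡ 1
leftAbs-pieceOf z≤n       = refl
leftAbs-pieceOf (s≤s z≤n) = refl

leftAbs≡1⇒code≤1 : ∀ P → leftAbs P ≡ 1 → code P ≤ 1
leftAbs≡1⇒code≤1 mono         _ = z≤n
leftAbs≡1⇒code≤1 (dimer zero) _ = s≤s z≤n

Close : ℕ → ℕ → Set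
Close a b = a ≤ suc b × b ≤ suc a

close? : ∀ a b → Dec (Close a b)
close? a b = (a ≤? suc b) ×-dec (b ≤? suc a)

Close-sym : ∀ {a b} → Close a b → Close b a
Close-sym (a≤1+b , b≤1+a) = b≤1+a , a≤1+b

Close-pred : ∀ a → Close (pred a) a
Close-pred zero    = z≤n , z≤n
Close-pred (suc a) = m≤n⇒m≤1+n (n≤1+n a) , ≤-refl

pred<self : ∀ {a} → 1 ≤ a → pred a < a
pred<self (s≤s _) = ≤-refl

Concurrent⇒Close : ∀ P Q → Concurrent P Q → Close (code P) (code Q)
Concurrent⇒Close mono       mono       _                                          = z≤n , z≤n
Concurrent⇒Close mono       (dimer .0) (_ , here refl , here refl)                = z≤n , s≤s z≤n
Concurrent⇒Close mono       (dimer _)  (_ , here refl , there (here ()))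
Concurrent⇒Close (dimer .0) mono       (_ , here refl , here refl)                = s≤s z≤n , z≤n
Concurrent⇒Close (dimer _)  mono       (_ , there (here ()) , here refl)
Concurrent⇒Close (dimer c)  (dimer .c) (_ , here refl , here refl)                = n≤1+n _ , n≤1+n _
Concurrent⇒Close (dimer _)  (dimer _)  (_ , here refl , there (here refl))        = ≤-refl , m≤n⇒m≤1+n (n≤1+n _)
Concurrent⇒Close (dimer _)  (dimer _)  (_ , there (here refl) , here refl)        = m≤n⇒m≤1+n (n≤1+n _) , ≤-refl
Concurrent⇒Close (dimer c)  (dimer .c) (_ , there (here refl) , there (here refl)) = n≤1+n _ , n≤1+n _

Close⇒Concurrent : ∀ P Q → Close (code P) (code Q) → Concurrent P Q
Close⇒Concurrent mono            mono            _            = 1 , here refl , here refl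
Close⇒Concurrent mono            (dimer zero)    _            = 1 , here refl , here refl
Close⇒Concurrent mono            (dimer (suc _)) (_ , s≤s ())
Close⇒Concurrent (dimer zero)    mono            _            = 1 , here refl , here refl
Close⇒Concurrent (dimer (suc _)) mono            (s≤s () , _)
Close⇒Concurrent (dimer c)       (dimer d)       (s≤s c≤1+d , s≤s d≤1+c) with <-cmp c d
... | tri≈ _ refl _ = suc c , here refl , here refl
... | tri< c<d _ _ rewrite ≤-antisym d≤1+c c<d = suc (suc c) , there (here refl) , here refl
... | tri> _ _ d<c rewrite ≤-antisym c≤1+d d<c = suc (suc d) , here refl , there (here refl)

Close⇒Concurrent-pieceOf : ∀ {a c} → Close a c → Concurrent (pieceOf a) (pieceOf c)
Close⇒Concurrent-pieceOf {a} {c} close =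
  Close⇒Concurrent _ _ (subst₂ Close (sym (code-pieceOf a)) (sym (code-pieceOf c)) close)

Concurrent-pieceOf⇒Close : ∀ {a c} → Concurrent (pieceOf a) (pieceOf c) → Close a c
Concurrent-pieceOf⇒Close {a} {c} conc =
  subst₂ Close (code-pieceOf a) (code-pieceOf c) (Concurrent⇒Close _ _ conc)

lookupℕ : List ℕ → ℕ → ℕ
lookupℕ []       _       = 0
lookupℕ (c ∷ _)  zero    = c
lookupℕ (_ ∷ cs) (suc k) = lookupℕ cs k

lookupℕ-tabulate : ∀ {n} (f : Fin n → ℕ) p → lookupℕ (tabulate f) (toℕ p) ≡ f p
lookupℕ-tabulate f zero    = refl
lookupℕ-tabulate f (suc p) = lookupℕ-tabulate (λ i → f (suc i)) p

tabulate-lookupℕ : ∀ cs → tabulate {n = length cs} (λ i → lookupℕ cs (toℕ i)) ≡ cs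
tabulate-lookupℕ []       = refl
tabulate-lookupℕ (c ∷ cs) = cong (c ∷_) (tabulate-lookupℕ cs)

SlowRise : ℕ → (ℕ → ℕ) → Set
SlowRise n b = ∀ k → suc k < n → b (suc k) ≤ suc (b k)

GradualSeq : ℕ → ℕ → (ℕ → ℕ) → Set
GradualSeq h n b = (0 < n → b 0 ≤ h) × SlowRise n b

data Gradual : ℕ → List ℕ → Set where
  []  : ∀ {h} → Gradual h []
  _∷_ : ∀ {h c cs} → c ≤ h → Gradual (suc c) cs → Gradual h (c ∷ cs)

slowRise-∷ : ∀ {c n} cs → GradualSeq (suc c) n (lookupℕ cs) → SlowRise (suc n) (lookupℕ (c ∷ cs))
slowRise-∷ cs (start , _)   zero    (s≤s 0<n)   = start 0<n
slowRise-∷ cs (_     , rise) (suc k) (s≤s 1+k<n) = rise k 1+k<n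

gradual⇒gradualSeq : ∀ {h cs} → Gradual h cs → GradualSeq h (length cs) (lookupℕ cs)
gradual⇒gradualSeq []                        = (λ ()) , (λ _ ())
gradual⇒gradualSeq (_∷_ {cs = cs} c≤h gradual) = (λ _ → c≤h) , slowRise-∷ cs (gradual⇒gradualSeq gradual)

gradualSeq⇒gradual : ∀ {h} cs → GradualSeq h (length cs) (lookupℕ cs) → Gradual h cs
gradualSeq⇒gradual []       _              = []
gradualSeq⇒gradual (c ∷ cs) (start , rise) =
  start (s≤s z≤n) ∷ gradualSeq⇒gradual cs ( (λ 0<n → rise 0 (s≤s 0<n))
                                          , (λ k 1+k<n → rise (suc k) (s≤s 1+k<n)))

gradual-weaken : ∀ {h h′ cs} → h ≤ h′ → Gradual h cs → Gradual h′ cs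
gradual-weaken h≤h′ []          = []
gradual-weaken h≤h′ (c≤h ∷ cs) = ≤-trans c≤h h≤h′ ∷ cs

intermediate-value : ∀ (s : ℕ → ℕ) {p q v} → p ≤ q → s p ≤ v → v < s q →
                     (∀ k → p ≤ k → k < q → s (suc k) ≤ suc (s k)) →
                     ∃ λ t → p ≤ t × t < q × s t ≡ v
intermediate-value s {q = q} p≤q sp≤v v<sq rise with m≤n⇒m<n∨m≡n p≤q
... | inj₂ refl = contradiction (≤-<-trans sp≤v v<sq) (<-irrefl refl)
intermediate-value s {q = suc q} {v} _ sp≤v v<sq rise | inj₁ (s≤s p≤q) with v <? s q
... | yes v<sq' =
  let t , p≤t , t<q , st≡v =
        intermediate-value s p≤q sp≤v v<sq' (λ k p≤k k<q → rise k p≤k (m≤n⇒m≤1+n k<q))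
  in  t , p≤t , m≤n⇒m≤1+n t<q , st≡v
... | no v≮sq' =
  q , p≤q , ≤-refl , ≤-antisym (≮⇒≥ v≮sq') (≤-pred (≤-trans v<sq (rise q p≤q ≤-refl)))

module HeapAxioms {k : ℕ} {H : Heap k} (isHeap : IsHeap H) where
  open Heap H using (_≼_; _≺_; _⋖_)

  ≼-refl : ∀ i → i ≼ i
  ≼-refl = proj₁ isHeap

  ≼-antisym : ∀ i j → i ≼ j → j ≼ i → i ≡ j
  ≼-antisym = proj₁ (proj₂ isHeap)

  ≼-trans : ∀ i j l → i ≼ j → j ≼ l → i ≼ l
  ≼-trans = proj₁ (proj₂ (proj₂ isHeap))

  concurrent⇒comparable : ∀ i j → Concurrent (lab H i) (lab H j) → i ≼ j ⊎ j ≼ i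
  concurrent⇒comparable = proj₁ (proj₂ (proj₂ (proj₂ isHeap)))

  cover⇒concurrent : ∀ i j → i ⋖ j → Concurrent (lab H i) (lab H j)
  cover⇒concurrent = proj₂ (proj₂ (proj₂ (proj₂ isHeap)))

  close⇒comparable : ∀ i j → Close (code (lab H i)) (code (lab H j)) → i ≼ j ⊎ j ≼ i
  close⇒comparable i j close = concurrent⇒comparable i j (Close⇒Concurrent _ _ close)

  cover⇒close : ∀ i j → i ⋖ j → Close (code (lab H i)) (code (lab H j))
  cover⇒close i j i⋖j = Concurrent⇒Close _ _ (cover⇒concurrent i j i⋖j)

  ≼? : ∀ i j → Dec (i ≼ j)
  ≼? i j = T? (le H i j)

  ≺? : ∀ i j → Dec (i ≺ j)
  ≺? i j = ≼? i j ×-dec ¬? (i Fin.≟ j)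

  isMaximal? : ∀ x → Dec (IsMaximal H x)
  isMaximal? x = all? (λ j → ≼? x j →-dec (j Fin.≟ x))

  ≼-isPartialOrder : IsPartialOrder _≡_ _≼_
  ≼-isPartialOrder = record
    { isPreorder = record
      { isEquivalence = isEquivalence
      ; reflexive     = λ { {i} refl → ≼-refl i }
      ; trans         = λ {i} {j} {l} → ≼-trans i j l
      }
    ; antisym = λ {i} {j} → ≼-antisym i j
    }

  ¬maximal⇒above : ∀ x → ¬ IsMaximal H x → ∃ λ y → x ≺ y
  ¬maximal⇒above x ¬x-max with ¬∀⟶∃¬ k _ (λ j → ≼? x j →-dec (j Fin.≟ x)) ¬x-max
  ... | y , ¬[x≼y⇒y≡x] with ≼? x y
  ...   | yes x≼y = y , x≼y , λ x≡y → ¬[x≼y⇒y≡x] (λ _ → sym x≡y)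
  ...   | no  x⋠y = contradiction (λ x≼y → contradiction x≼y x⋠y) ¬[x≼y⇒y≡x]

  maximal-above : ∀ x → ∃ λ m → x ≼ m × IsMaximal H m
  maximal-above x = go x (po-noetherian ≼-isPartialOrder x)
    where
    go : ∀ x → Acc (flip _≺_) x → ∃ λ m → x ≼ m × IsMaximal H m
    go x (acc rec) with isMaximal? x
    ... | yes x-max = x , ≼-refl x , x-max
    ... | no ¬x-max =
      let y , x≺y@(x≼y , _) = ¬maximal⇒above x ¬x-max
          m , y≼m , m-max   = go y (rec x≺y)
      in  m , ≼-trans x y m x≼y y≼m , m-max

  cover-above : ∀ i j → i ≺ j → ∃ λ m → i ⋖ m × m ≼ j
  cover-above i j = go j (po-wellFounded ≼-isPartialOrder j)
    where
    go : ∀ j → Acc _≺_ j → i ≺ j → ∃ λ m → i ⋖ m × m ≼ j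
    go j (acc rec) i≺j with any? (λ m → ≺? i m ×-dec ≺? m j)
    ... | no none = j , (i≺j , λ m between → none (m , between)) , ≼-refl j
    ... | yes (m , i≺m , m≺j@(m≼j , _)) =
      let m′ , i⋖m′ , m′≼m = go m (rec m≺j) i≺m
      in  m′ , i⋖m′ , ≼-trans m′ m j m′≼m m≼j

-- The heap of a code sequence

-- Pieces are dropped one after the other, the i-th with code b i: the i-th
-- lies below the j-th exactly when a chain of successively concurrent pieces,
-- increasing in index, leads from j to i.
data Reach (b : ℕ → ℕ) (p : ℕ) : ℕ → Set where
  here : Reach b p p
  step : ∀ {r q} → Reach b p r → r < q → Close (b r) (b q) → Reach b p q

module _ {b : ℕ → ℕ} where

  reach⇒≤ : ∀ {p q} → Reach b p q → p ≤ q
  reach⇒≤ here           = ≤-refl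
  reach⇒≤ (step R r<q _) = <⇒≤ (≤-<-trans (reach⇒≤ R) r<q)

  reach-trans : ∀ {p q r} → Reach b p q → Reach b q r → Reach b p r
  reach-trans R here           = R
  reach-trans R (step S r<q c) = step (reach-trans R S) r<q c

  reach-last : ∀ {p q} → Reach b p q → p ≢ q → ∃ λ r → r < q × Reach b p r × Close (b r) (b q)
  reach-last here           p≢p = contradiction refl p≢p
  reach-last (step R r<q c) _   = _ , r<q , R , c

  reach? : ∀ p q → Dec (Reach b p q)
  reach? p = <-rec (λ q → Dec (Reach b p q)) decide
    where
    decide : ∀ q → (∀ {r} → r < q → Dec (Reach b p r)) → Dec (Reach b p q)
    decide q rec with p ≟ q
    ... | yes refl = yes here
    ... | no p≢q   = map′ fromLast toLast
                       (any? λ (r : Fin q) → rec (toℕ<n r) ×-dec close? (b (toℕ r)) (b q))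
      where
      fromLast : ∃ (λ (r : Fin q) → Reach b p (toℕ r) × Close (b (toℕ r)) (b q)) → Reach b p q
      fromLast (r , R , c) = step R (toℕ<n r) c

      toLast : Reach b p q → ∃ λ (r : Fin q) → Reach b p (toℕ r) × Close (b (toℕ r)) (b q)
      toLast R with reach-last R p≢q
      ... | r , r<q , R′ , c =
        fromℕ< r<q , subst (λ x → Reach b p x × Close (b x) (b q)) (sym (toℕ-fromℕ< r<q)) (R′ , c)

heapOf : ∀ n → (ℕ → ℕ) → Heap n
heapOf n b = record
  { lab = λ i → pieceOf (b (toℕ i))
  ; le  = λ i j → isYes (reach? {b = b} (toℕ j) (toℕ i))
  }

module _ {n : ℕ} {b : ℕ → ℕ} where
  open Heap (heapOf n b) using (_≼_)

  ≼⇒reach : ∀ {i j} → i ≼ j → Reach b (toℕ j) (toℕ i)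
  ≼⇒reach = toWitness

  reach⇒≼ : ∀ {i j} → Reach b (toℕ j) (toℕ i) → i ≼ j
  reach⇒≼ = fromWitness

heapOf-isHeap : ∀ n b → IsHeap (heapOf n b)
heapOf-isHeap n b =
    (λ i → reach⇒≼ here)
  , (λ i j i≼j j≼i → toℕ-injective (≤-antisym (reach⇒≤ (≼⇒reach j≼i))
                                               (reach⇒≤ (≼⇒reach i≼j))))
  , (λ i j l i≼j j≼l → reach⇒≼ (reach-trans (≼⇒reach j≼l) (≼⇒reach i≼j)))
  , comparable
  , cover⇒concurrent
  where
  open Heap (heapOf n b) using (_≼_; _⋖_)

  comparable : ∀ i j → Concurrent (pieceOf (b (toℕ i))) (pieceOf (b (toℕ j))) → i ≼ j ⊎ j ≼ i
  comparable i j conc with <-cmp (toℕ i) (toℕ j)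
  ... | tri< i<j _ _ = inj₂ (reach⇒≼ (step here i<j (Concurrent-pieceOf⇒Close conc)))
  ... | tri≈ _ i≡j _ = inj₁ (subst (i ≼_) (toℕ-injective i≡j) (reach⇒≼ here))
  ... | tri> _ _ j<i = inj₁ (reach⇒≼ (step here j<i (Close-sym (Concurrent-pieceOf⇒Close conc))))

  cover⇒concurrent : ∀ i j → i ⋖ j → Concurrent (pieceOf (b (toℕ i))) (pieceOf (b (toℕ j)))
  cover⇒concurrent i j ((i≼j , i≢j) , nothing-between)
    with reach-last (≼⇒reach i≼j) (λ j≡i → i≢j (toℕ-injective (sym j≡i)))
  ... | r , r<i , R , c = last-step (fromℕ< (<-trans r<i (toℕ<n i))) (toℕ-fromℕ< _) R r<i c
    where
    last-step : ∀ m {r} → toℕ m ≡ r → Reach b (toℕ j) r → r < toℕ i → Close (b r) (b (toℕ i)) →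
                Concurrent (pieceOf (b (toℕ i))) (pieceOf (b (toℕ j)))
    last-step m refl R m<i c with m Fin.≟ j
    ... | yes refl = Close⇒Concurrent-pieceOf (Close-sym c)
    ... | no m≢j   = contradiction ((reach⇒≼ (step here m<i c) , λ i≡m → <-irrefl (cong toℕ (sym i≡m)) m<i)
                                   , (reach⇒≼ R , m≢j))
                                   (nothing-between m)

gradual-reach-top : ∀ {n b} → GradualSeq 1 n b → ∀ q → q < n → Reach b 0 q
gradual-reach-top {n} {b} (start , rise) = <-rec (λ q → q < n → Reach b 0 q) reach
  where
  reach : ∀ q → (∀ {r} → r < q → r < n → Reach b 0 r) → q < n → Reach b 0 q
  reach zero    _   _     = here
  reach (suc q) rec 1+q<n with b (suc q) ≤? 1
  ... | yes bq≤1 = step here (s≤s z≤n) (≤-trans b0≤1 (s≤s z≤n) , ≤-trans bq≤1 (s≤s z≤n))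
    where
    b0≤1 : b 0 ≤ 1
    b0≤1 = start (≤-trans (s≤s z≤n) 1+q<n)
  ... | no bq≰1 =
    let t , _ , t<1+q , bt≡ = intermediate-value b z≤n
                                (≤-trans (start (≤-trans (s≤s z≤n) 1+q<n)) (pred-mono-≤ (≰⇒> bq≰1)))
                                (pred<self (≤-trans (s≤s z≤n) (≰⇒> bq≰1)))
                                (λ k _ k<1+q → rise k (≤-<-trans k<1+q 1+q<n))
    in  step (rec t<1+q (<-trans t<1+q 1+q<n)) t<1+q (subst (λ c → Close c (b (suc q))) (sym bt≡) (Close-pred _))

heapOf-admissible : ∀ {n b} → GradualSeq 1 n b → Admissible (heapOf n b)
heapOf-admissible {zero}  {b} _ = heapOf-isHeap 0 b , inj₁ refl
heapOf-admissible {suc n} {b} gradual@(start , _) =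
  heapOf-isHeap (suc n) b , inj₂ (zero , zero-maximal , leftAbs-pieceOf (start (s≤s z≤n)) , top-unique)
  where
  zero-maximal : IsMaximal (heapOf (suc n) b) zero
  zero-maximal j zero≼j = toℕ-injective (n≤0⇒n≡0 (reach⇒≤ (≼⇒reach zero≼j)))

  top-unique : ∀ j → IsMaximal (heapOf (suc n) b) j → j ≡ zero
  top-unique j j-max = sym (j-max zero (reach⇒≼ (gradual-reach-top gradual (toℕ j) (toℕ<n j))))

-- A linear extension listed top-down: position zero holds a maximal piece.
record LinearExt {n} (H : Heap n) : Set where
  field
    order    : Permutation′ n
    antitone : ∀ p q → T (le H (order ⟨$⟩ʳ p) (order ⟨$⟩ʳ q)) → toℕ q ≤ toℕ p

  elt pos : Fin n → Fin n
  elt p = order ⟨$⟩ʳ p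
  pos x = order ⟨$⟩ˡ x

  elt-pos : ∀ x → elt (pos x) ≡ x
  elt-pos x = inverseʳ order

  pos-elt : ∀ p → pos (elt p) ≡ p
  pos-elt p = inverseˡ order

  pos-antitone : ∀ {x y} → T (le H x y) → toℕ (pos y) ≤ toℕ (pos x)
  pos-antitone {x} {y} x≼y =
    antitone (pos x) (pos y) (subst₂ (λ u v → T (le H u v)) (sym (elt-pos x)) (sym (elt-pos y)) x≼y)

  pos-strict : ∀ {x y} → T (le H x y) → x ≢ y → toℕ (pos y) < toℕ (pos x)
  pos-strict {x} {y} x≼y x≢y with m≤n⇒m<n∨m≡n (pos-antitone x≼y)
  ... | inj₁ <pos = <pos
  ... | inj₂ ≡pos =
    contradiction (trans (sym (elt-pos x)) (trans (cong elt (toℕ-injective (sym ≡pos))) (elt-pos y))) x≢y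

  codes : List ℕ
  codes = tabulate (λ p → code (lab H (elt p)))

  codeSeq : ℕ → ℕ
  codeSeq = lookupℕ codes

  codeSeq-toℕ : ∀ p → codeSeq (toℕ p) ≡ code (lab H (elt p))
  codeSeq-toℕ = lookupℕ-tabulate (λ p → code (lab H (elt p)))

  codeSeq-pos : ∀ x → codeSeq (toℕ (pos x)) ≡ code (lab H x)
  codeSeq-pos x = trans (codeSeq-toℕ (pos x)) (cong (λ u → code (lab H u)) (elt-pos x))

  length-codes : length codes ≡ n
  length-codes = length-tabulate (λ p → code (lab H (elt p)))

NormalExt : ∀ {n} → Heap n → Set
NormalExt {n} H = Σ (LinearExt H) λ E → SlowRise n (LinearExt.codeSeq E)

top-maximal : ∀ {n} {H : Heap n} (E : LinearExt H) t → toℕ t ≡ 0 → IsMaximal H (LinearExt.elt E t)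
top-maximal E t t≡0 j top≼j =
  trans (sym (elt-pos j)) (cong elt (toℕ-injective (trans (n≤0⇒n≡0 bound) (sym t≡0))))
  where
  open LinearExt E
  bound : toℕ (pos j) ≤ 0
  bound = subst (toℕ (pos j) ≤_) (trans (cong toℕ (pos-elt t)) t≡0) (pos-antitone top≼j)

heapOf-linearExt : ∀ n b → LinearExt (heapOf n b)
heapOf-linearExt n b = record { order = Perm.id ; antitone = λ p q p≼q → reach⇒≤ (≼⇒reach p≼q) }

heapOf-codes : ∀ {n} cs → length cs ≡ n → LinearExt.codes (heapOf-linearExt n (lookupℕ cs)) ≡ cs
heapOf-codes cs refl = trans (tabulate-cong (λ p → code-pieceOf (lookupℕ cs (toℕ p)))) (tabulate-lookupℕ cs)

heapOf-normalExt : ∀ {n} cs → length cs ≡ n → SlowRise n (lookupℕ cs) → NormalExt (heapOf n (lookupℕ cs))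
heapOf-normalExt {n} cs len slow =
  heapOf-linearExt n (lookupℕ cs) , subst (λ ds → SlowRise n (lookupℕ ds)) (sym (heapOf-codes cs len)) slow

module _ {n : ℕ} {H H′ : Heap n} (iso : HeapIso H H′) where
  private
    σ : Permutation′ n
    σ = proj₁ iso

  le-from : ∀ x y → le H (σ ⟨$⟩ˡ x) (σ ⟨$⟩ˡ y) ≡ le H′ x y
  le-from x y =
    trans (sym (proj₂ (proj₂ iso) (σ ⟨$⟩ˡ x) (σ ⟨$⟩ˡ y))) (cong₂ (le H′) (inverseʳ σ) (inverseʳ σ))

  code-from : ∀ x → code (lab H (σ ⟨$⟩ˡ x)) ≡ code (lab H′ x)
  code-from x = cong code (trans (sym (proj₁ (proj₂ iso) (σ ⟨$⟩ˡ x))) (cong (lab H′) (inverseʳ σ)))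

  linearExt-transport : LinearExt H′ → LinearExt H
  linearExt-transport E′ = record
    { order    = order ∘ₚ Perm.flip σ
    ; antitone = λ p q p≼q → antitone p q (subst T (le-from (elt p) (elt q)) p≼q)
    }
    where open LinearExt E′

  codes-transport : ∀ E′ → LinearExt.codes (linearExt-transport E′) ≡ LinearExt.codes E′
  codes-transport E′ = tabulate-cong (λ p → code-from (LinearExt.elt E′ p))

  normalExt-transport : NormalExt H′ → NormalExt H
  normalExt-transport (E′ , slow) =
    linearExt-transport E′ , subst (λ cs → SlowRise n (lookupℕ cs)) (sym (codes-transport E′)) slow

T-ext : ∀ {x y} → (T x → T y) → (T y → T x) → x ≡ y
T-ext {false} {false} _ _ = refl
T-ext {false} {true}  _ g = ⊥-elim (g _)
T-ext {true}  {false} f _ = ⊥-elim (f _)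
T-ext {true}  {true}  _ _ = refl

module _ {n : ℕ} {H : Heap n} (isHeap : IsHeap H) (E : LinearExt H) where
  open HeapAxioms isHeap
  open LinearExt E
  open Heap H using (_≼_; _≺_)

  reach⇒below : ∀ {p q} → Reach codeSeq p q → ∀ i j → toℕ i ≡ p → toℕ j ≡ q → elt j ≼ elt i
  reach⇒below here           i j i≡p j≡p =
    subst (λ u → elt j ≼ elt u) (toℕ-injective (trans j≡p (sym i≡p))) (≼-refl (elt j))
  reach⇒below (step R r<q c) i j refl refl = extend (fromℕ< (<-trans r<q (toℕ<n j))) (toℕ-fromℕ< _) R r<q c
    where
    extend : ∀ m {r} → toℕ m ≡ r → Reach codeSeq (toℕ i) r → r < toℕ j →
             Close (codeSeq r) (codeSeq (toℕ j)) → elt j ≼ elt i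
    extend m refl R m<j c with close⇒comparable (elt m) (elt j) (subst₂ Close (codeSeq-toℕ m) (codeSeq-toℕ j) c)
    ... | inj₁ m≼j = contradiction (antitone m j m≼j) (<⇒≱ m<j)
    ... | inj₂ j≼m = ≼-trans _ _ _ j≼m (reach⇒below R i m refl refl)

  below⇒reach : ∀ x y → x ≼ y → Reach codeSeq (toℕ (pos y)) (toℕ (pos x))
  below⇒reach x = go x (po-noetherian ≼-isPartialOrder x)
    where
    go : ∀ x → Acc (flip _≺_) x → ∀ y → x ≼ y → Reach codeSeq (toℕ (pos y)) (toℕ (pos x))
    go x (acc rec) y x≼y with x Fin.≟ y
    ... | yes refl = here
    ... | no x≢y with cover-above x y (x≼y , x≢y)
    ...   | m , x⋖m@((x≼m , x≢m) , _) , m≼y =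
      step (go m (rec (x≼m , x≢m)) y m≼y) (pos-strict x≼m x≢m)
           (subst₂ Close (sym (codeSeq-pos m)) (sym (codeSeq-pos x)) (Close-sym (cover⇒close x m x⋖m)))

  linearExt-iso : HeapIso H (heapOf n codeSeq)
  linearExt-iso = Perm.flip order , lab-pos , le-pos
    where
    lab-pos : ∀ x → pieceOf (codeSeq (toℕ (pos x))) ≡ lab H x
    lab-pos x = trans (cong pieceOf (codeSeq-pos x)) (pieceOf-code (lab H x))

    le-pos : ∀ x y → le (heapOf n codeSeq) (pos x) (pos y) ≡ le H x y
    le-pos x y = T-ext
      (λ below → subst₂ _≼_ (elt-pos x) (elt-pos y) (reach⇒below (≼⇒reach below) (pos y) (pos x) refl refl))
      (λ x≼y → reach⇒≼ (below⇒reach x y x≼y))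

-- Uniqueness of the greedy normal form

module _ {n : ℕ} {H : Heap n} (isHeap : IsHeap H) where
  open HeapAxioms isHeap
  open LinearExt

  AgreeBelow : LinearExt H → LinearExt H → Fin n → Set
  AgreeBelow E E′ p = ∀ r → toℕ r < toℕ p → elt E r ≡ elt E′ r

  agree-sym : ∀ {E E′ p} → AgreeBelow E E′ p → AgreeBelow E′ E p
  agree-sym agree r r<p = sym (agree r r<p)

  pos-agree : ∀ E E′ {p z} → AgreeBelow E E′ p → toℕ (pos E′ z) < toℕ p → pos E z ≡ pos E′ z
  pos-agree E E′ {z = z} agree <p =
    trans (cong (pos E) (trans (sym (elt-pos E′ z)) (sym (agree (pos E′ z) <p)))) (pos-elt E (pos E′ z))

  placed-later : ∀ E E′ {p} → AgreeBelow E E′ p → elt E p ≢ elt E′ p →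
                 toℕ p < toℕ (pos E′ (elt E p))
  placed-later E E′ {p} agree x≢y with <-cmp (toℕ (pos E′ (elt E p))) (toℕ p)
  ... | tri< <p _ _ =
    contradiction (trans (cong toℕ (sym (pos-agree E E′ agree <p))) (cong toℕ (pos-elt E p))) (<⇒≢ <p)
  ... | tri≈ _ ≡p _ =
    contradiction (trans (sym (elt-pos E′ (elt E p))) (cong (elt E′) (toℕ-injective ≡p))) x≢y
  ... | tri> _ _ >p = >p

  -- If the codes of x and y differed by two or more, the slowly rising codes of
  -- E would pass through code y − 1 between x and y, at a piece that E′ must
  -- also place before y.
  no-jump : ∀ E E′ → SlowRise n (codeSeq E) → ∀ {p} → AgreeBelow E E′ p → elt E p ≢ elt E′ p →
            ¬ (2 + code (lab H (elt E p)) ≤ code (lab H (elt E′ p)))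
  no-jump E E′ slow {p} agree x≢y jump =
    let t , p≤t , t<q , st≡ = intermediate-value (codeSeq E) (<⇒≤ p<q)
                                (subst (_≤ pred cy) (sym (codeSeq-toℕ E p))
                                       (≤-trans (n≤1+n _) (pred-mono-≤ jump)))
                                (subst (pred cy <_) (sym sq≡cy) pred-cy<cy)
                                (λ k _ k<q → slow k (≤-<-trans k<q (toℕ<n q)))
        t<n : t < n
        t<n = <-trans t<q (toℕ<n q)
        z-at-t : toℕ (pos E (elt E (fromℕ< t<n))) ≡ t
        z-at-t = trans (cong toℕ (pos-elt E (fromℕ< t<n))) (toℕ-fromℕ< t<n)
    in  conclude (elt E (fromℕ< t<n)) (subst (toℕ p ≤_) (sym z-at-t) p≤t) (subst (_< toℕ q) (sym z-at-t) t<q)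
                 (trans (sym (codeSeq-toℕ E (fromℕ< t<n))) (trans (cong (codeSeq E) (toℕ-fromℕ< t<n)) st≡))
    where
    y : Fin n
    y = elt E′ p

    cy : ℕ
    cy = code (lab H y)

    pred-cy<cy : pred cy < cy
    pred-cy<cy = pred<self (≤-trans (s≤s z≤n) jump)

    q : Fin n
    q = pos E y

    p<q : toℕ p < toℕ q
    p<q = placed-later E′ E (agree-sym {E} {E′} agree) (≢-sym x≢y)

    sq≡cy : codeSeq E (toℕ q) ≡ cy
    sq≡cy = codeSeq-pos E y

    conclude : ∀ z → toℕ p ≤ toℕ (pos E z) → toℕ (pos E z) < toℕ q → code (lab H z) ≡ pred cy → ⊥
    conclude z p≤z z<q cz≡ with close⇒comparable z y (subst (λ c → Close c cy) (sym cz≡) (Close-pred cy))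
    ... | inj₁ z≼y = <-irrefl refl (≤-<-trans (pos-antitone E z≼y) z<q)
    ... | inj₂ y≼z
      with m≤n⇒m<n∨m≡n (subst (λ u → toℕ (pos E′ z) ≤ toℕ u) (pos-elt E′ p) (pos-antitone E′ y≼z))
    ...   | inj₁ z<p =
      <-irrefl refl (<-≤-trans (subst (_< toℕ p) (cong toℕ (sym (pos-agree E E′ agree z<p))) z<p) p≤z)
    ...   | inj₂ z≡p = <-irrefl (cong (λ u → code (lab H u)) z≡y) (subst (_< cy) (sym cz≡) pred-cy<cy)
      where
      z≡y : z ≡ y
      z≡y = trans (sym (elt-pos E′ z)) (cong (elt E′) (toℕ-injective z≡p))

  elt-agree : ∀ (E E′ : NormalExt H) {p} → AgreeBelow (proj₁ E) (proj₁ E′) p →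
              elt (proj₁ E) p ≡ elt (proj₁ E′) p
  elt-agree (E , slow) (E′ , slow′) {p} agree with elt E p Fin.≟ elt E′ p
  ... | yes x≡y = x≡y
  ... | no x≢y with close? (code (lab H (elt E p))) (code (lab H (elt E′ p)))
  ...   | yes close with close⇒comparable (elt E p) (elt E′ p) close
  ...     | inj₁ x≼y =
    contradiction (subst (λ u → toℕ (pos E (elt E′ p)) ≤ toℕ u) (pos-elt E p) (pos-antitone E x≼y))
                  (<⇒≱ (placed-later E′ E (agree-sym {E} {E′} agree) (≢-sym x≢y)))
  ...     | inj₂ y≼x =
    contradiction (subst (λ u → toℕ (pos E′ (elt E p)) ≤ toℕ u) (pos-elt E′ p) (pos-antitone E′ y≼x))
                  (<⇒≱ (placed-later E E′ agree x≢y))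
  elt-agree (E , slow) (E′ , slow′) {p} agree | no x≢y | no ¬close
    with code (lab H (elt E p)) ≤? suc (code (lab H (elt E′ p)))
  ... | yes x≤1+y = ⊥-elim (no-jump E E′ slow agree x≢y (≰⇒> (λ y≤1+x → ¬close (x≤1+y , y≤1+x))))
  ... | no  x≰1+y = ⊥-elim (no-jump E′ E slow′ (agree-sym {E} {E′} agree) (≢-sym x≢y) (≰⇒> x≰1+y))

  normalExt-unique : ∀ (E E′ : NormalExt H) p → elt (proj₁ E) p ≡ elt (proj₁ E′) p
  normalExt-unique E E′ p = go p (<ᶠ-wellFounded p)
    where
    go : ∀ p → Acc Fin._<_ p → elt (proj₁ E) p ≡ elt (proj₁ E′) p
    go p (acc rec) = elt-agree E E′ (λ r r<p → go r (rec r<p))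

normalExt-codes-invariant : ∀ {n} {H H′ : Heap n} → IsHeap H → HeapIso H H′ →
                            (E : NormalExt H) (E′ : NormalExt H′) →
                            LinearExt.codes (proj₁ E) ≡ LinearExt.codes (proj₁ E′)
normalExt-codes-invariant {H = H} isHeap σ E E′ = begin
  LinearExt.codes (proj₁ E)
    ≡⟨ tabulate-cong (λ p → cong (λ x → code (lab H x)) (normalExt-unique isHeap E E″ p)) ⟩
  LinearExt.codes (proj₁ E″)
    ≡⟨ codes-transport σ (proj₁ E′) ⟩
  LinearExt.codes (proj₁ E′)
    ∎
  where
  open ≡-Reasoning
  E″ : NormalExt H
  E″ = normalExt-transport σ E′

heapOf-injective : ∀ {n} cs cs′ → length cs ≡ n → length cs′ ≡ n →
                   SlowRise n (lookupℕ cs) → SlowRise n (lookupℕ cs′) →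
                   HeapIso (heapOf n (lookupℕ cs)) (heapOf n (lookupℕ cs′)) → cs ≡ cs′
heapOf-injective {n} cs cs′ len len′ slow slow′ σ = begin
  cs                          ≡⟨ heapOf-codes cs len ⟨
  LinearExt.codes (proj₁ E)   ≡⟨ normalExt-codes-invariant (heapOf-isHeap n _) σ E E′ ⟩
  LinearExt.codes (proj₁ E′)  ≡⟨ heapOf-codes cs′ len′ ⟩
  cs′                         ∎
  where
  open ≡-Reasoning
  E : NormalExt (heapOf n (lookupℕ cs))
  E = heapOf-normalExt cs len slow
  E′ : NormalExt (heapOf n (lookupℕ cs′))
  E′ = heapOf-normalExt cs′ len′ slow′

-- Existence of the greedy normal form

punchIn-onto : ∀ {n} {x j : Fin (suc n)} → j ≢ x → ∃ λ j′ → punchIn x j′ ≡ j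
punchIn-onto j≢x = punchOut (λ x≡j → j≢x (sym x≡j)) , punchIn-punchOut _

restrict : ∀ {n} → Heap (suc n) → Fin (suc n) → Heap n
restrict H x = record
  { lab = λ i → lab H (punchIn x i)
  ; le  = λ i j → le H (punchIn x i) (punchIn x j)
  }

restrict-isHeap : ∀ {n} {H : Heap (suc n)} {x} → IsHeap H → IsMaximal H x → IsHeap (restrict H x)
restrict-isHeap {H = H} {x} isHeap x-max =
    (λ i → ≼-refl (punchIn x i))
  , (λ i j i≼j j≼i → punchIn-injective x i j (≼-antisym _ _ i≼j j≼i))
  , (λ i j l → ≼-trans _ _ _)
  , (λ i j → concurrent⇒comparable _ _)
  , (λ i j i⋖j → cover⇒concurrent _ _ (lift-cover i j i⋖j))
  where
  open HeapAxioms isHeap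
  open Heap H using (_≺_; _⋖_)
  open Heap (restrict H x) using () renaming (_⋖_ to _⋖′_)

  lift-cover : ∀ i j → i ⋖′ j → punchIn x i ⋖ punchIn x j
  lift-cover i j ((i≼j , i≢j) , nothing-between) =
    (i≼j , λ i≡j → i≢j (punchIn-injective x i j i≡j)) , no-lift
    where
    no-lift : ∀ m → ¬ (punchIn x i ≺ m × m ≺ punchIn x j)
    no-lift m (_ , (m≼j , _)) with m Fin.≟ x
    ... | yes refl = punchInᵢ≢i x j (x-max _ m≼j)
    no-lift m ((i≼m , i≢m) , (m≼j , m≢j)) | no m≢x with punchIn-onto m≢x
    ... | m′ , refl = nothing-between m′ ( (i≼m , λ i≡m′ → i≢m (cong (punchIn x) i≡m′))
                                         , (m≼j , λ m′≡j → m≢j (cong (punchIn x) m′≡j)))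

greedy-top : ∀ {n} {H : Heap (suc n)} → IsHeap H →
             ∃ λ x → IsMaximal H x × (∀ y → IsMaximal H y → code (lab H y) ≤ code (lab H x))
greedy-top {n} {H} isHeap =
    argmax codeOf some-max maximals
  , argmax-all codeOf (proj₂ (proj₂ (maximal-above zero))) (all-filter isMaximal? (allFin (suc n)))
  , λ y y-max → All.lookup (f[xs]≤f[argmax] some-max maximals) (∈-filter⁺ isMaximal? (∈-allFin y) y-max)
  where
  open HeapAxioms isHeap
  codeOf : Fin (suc n) → ℕ
  codeOf y = code (lab H y)
  some-max : Fin (suc n)
  some-max = proj₁ (maximal-above zero)
  maximals : List (Fin (suc n))
  maximals = filter isMaximal? (allFin (suc n))

module _ {n : ℕ} {H : Heap (suc n)} (isHeap : IsHeap H) {x : Fin (suc n)} (x-max : IsMaximal H x)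
         (x-greedy : ∀ y → IsMaximal H y → code (lab H y) ≤ code (lab H x)) where
  open HeapAxioms isHeap
  open Heap H using (_≼_; _⋖_)

  maximal-after-removal : ∀ {y′} → IsMaximal (restrict H x) y′ →
                          ∀ j → j ≢ x → punchIn x y′ ≼ j → j ≡ punchIn x y′
  maximal-after-removal y′-max j j≢x y≼j with punchIn-onto j≢x
  ... | j′ , refl = cong (punchIn x) (y′-max j′ y≼j)

  code-after-removal : ∀ {y′} → IsMaximal (restrict H x) y′ →
                       code (lab H (punchIn x y′)) ≤ suc (code (lab H x))
  code-after-removal {y′} y′-max with ≼? (punchIn x y′) x
  ... | no y⋠x  = ≤-trans (x-greedy _ y-max) (n≤1+n _)
    where
    y-max : IsMaximal H (punchIn x y′)
    y-max j y≼j with j Fin.≟ x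
    ... | yes refl = contradiction y≼j y⋠x
    ... | no j≢x   = maximal-after-removal y′-max j j≢x y≼j
  ... | yes y≼x = proj₁ (cover⇒close _ x y⋖x)
    where
    y⋖x : punchIn x y′ ⋖ x
    y⋖x = (y≼x , punchInᵢ≢i x y′)
        , λ m ((y≼m , y≢m) , (_ , m≢x)) → y≢m (sym (maximal-after-removal y′-max m m≢x y≼m))

  normalExt-extend : NormalExt (restrict H x) → NormalExt H
  normalExt-extend (E′ , slow′) =
    E , subst (λ cs → SlowRise (suc n) (lookupℕ cs)) (sym codes-E)
              (slowRise-∷ (LinearExt.codes E′) (start , slow′))
    where
    open LinearExt E′ using (order; antitone; codes; codeSeq; codeSeq-toℕ) renaming (elt to elt′)

    E : LinearExt H
    E = record { order = Perm.insert zero x order ; antitone = antitone-E }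
      where
      elt-suc : ∀ p → Perm.insert zero x order ⟨$⟩ʳ suc p ≡ punchIn x (elt′ p)
      elt-suc = insert-punchIn zero x order

      antitone-E : ∀ p q → (Perm.insert zero x order ⟨$⟩ʳ p) ≼ (Perm.insert zero x order ⟨$⟩ʳ q) →
                   toℕ q ≤ toℕ p
      antitone-E p       zero    _   = z≤n
      antitone-E zero    (suc q) x≼q =
        contradiction (trans (sym (elt-suc q)) (x-max _ x≼q)) (punchInᵢ≢i x (elt′ q))
      antitone-E (suc p) (suc q) p≼q = s≤s (antitone p q (subst₂ _≼_ (elt-suc p) (elt-suc q) p≼q))

    codes-E : LinearExt.codes E ≡ code (lab H x) ∷ codes
    codes-E = cong (code (lab H x) ∷_)
                   (tabulate-cong (λ p → cong (λ u → code (lab H u)) (insert-punchIn zero x order p)))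

    start : 0 < n → lookupℕ codes 0 ≤ suc (code (lab H x))
    start 0<n = subst (_≤ suc (code (lab H x)))
                      (trans (sym (codeSeq-toℕ t)) (cong codeSeq (toℕ-fromℕ< 0<n)))
                      (code-after-removal (top-maximal E′ t (toℕ-fromℕ< 0<n)))
      where
      t : Fin n
      t = fromℕ< 0<n

normalExt-exists : ∀ {n} {H : Heap n} → IsHeap H → NormalExt H
normalExt-exists {zero}  isHeap = record { order = Perm.id ; antitone = λ () } , λ _ ()
normalExt-exists {suc n} isHeap =
  let x , x-max , x-greedy = greedy-top isHeap
  in  normalExt-extend isHeap x-max x-greedy (normalExt-exists (restrict-isHeap isHeap x-max))

-- Dyck paths and the heights of their up steps

levels : ℕ → List Step → List ℕ
levels h []      = []
levels h (U ∷ w) = h ∷ levels (suc h) w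
levels h (D ∷ w) = levels (pred h) w

unlevels : ℕ → List ℕ → List Step
unlevels h []       = replicate h D
unlevels h (c ∷ cs) = replicate (h ∸ c) D ++ U ∷ unlevels (suc c) cs

zeros : List ℕ → ℕ
zeros = countᵇ (_≡ᵇ 0)

triangle : ℕ → ℕ
triangle zero    = 0
triangle (suc h) = h + triangle h

dyckFrom-U : ∀ h w → dyckFrom h (U ∷ w) ≡ dyckFrom (suc h) w
dyckFrom-U zero    w = refl
dyckFrom-U (suc h) w = refl

levels-gradual : ∀ {h} w → T (dyckFrom h w) → Gradual h (levels h w)
levels-gradual {zero}  []      _    = []
levels-gradual {h}     (U ∷ w) dyck = ≤-refl ∷ levels-gradual w (subst T (dyckFrom-U h w) dyck)
levels-gradual {suc h} (D ∷ w) dyck = gradual-weaken (n≤1+n h) (levels-gradual w dyck)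

length-levels : ∀ {h} w → T (dyckFrom h w) → length w ≡ 2 * length (levels h w) + h
length-levels {zero}  []      _    = refl
length-levels {h}     (U ∷ w) dyck = trans (cong suc (length-levels w (subst T (dyckFrom-U h w) dyck)))
                                           (arith (length (levels (suc h) w)) h)
  where
  arith : ∀ l h → suc (2 * l + suc h) ≡ 2 * suc l + h
  arith = solve-∀
length-levels {suc h} (D ∷ w) dyck = trans (cong suc (length-levels w dyck)) (sym (+-suc _ h))

-- Returns to level 0 are the up steps taken at height 0, plus a final descent
-- to 0 when starting above it.
returns-levels : ∀ {h} w → T (dyckFrom h w) → returnsFrom h w ≡ 1 ⊓ h + zeros (levels h w)
returns-levels {zero}        []      _    = refl
returns-levels {zero}        (U ∷ w) dyck = returns-levels w dyck
returns-levels {suc h}       (U ∷ w) dyck = returns-levels w dyck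
returns-levels {suc zero}    (D ∷ w) dyck = cong suc (returns-levels w dyck)
returns-levels {suc (suc h)} (D ∷ w) dyck = returns-levels w dyck

area-levels : ∀ {h} i w → T (dyckFrom h w) → columnsArea i (heightsOfD (h + i) w) ≡ sum (levels h w) + triangle h
area-levels {zero}  i []      _    = refl
area-levels {h}     i (U ∷ w) dyck = begin
  columnsArea i (heightsOfD (suc h + i) w)   ≡⟨ area-levels i w (subst T (dyckFrom-U h w) dyck) ⟩
  sum (levels (suc h) w) + (h + triangle h)   ≡⟨ sym (+-assoc (sum (levels (suc h) w)) h (triangle h)) ⟩
  sum (levels (suc h) w) + h + triangle h     ≡⟨ cong (_+ triangle h) (+-comm (sum (levels (suc h) w)) h) ⟩
  h + sum (levels (suc h) w) + triangle h     ∎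
  where open ≡-Reasoning
area-levels {suc h} i (D ∷ w) dyck = begin
  suc h + i ∸ suc i + columnsArea (suc i) (heightsOfD (suc h + i) w)
    ≡⟨ cong₂ _+_ (m+n∸n≡m h i) (cong (λ k → columnsArea (suc i) (heightsOfD k w)) (sym (+-suc h i))) ⟩
  h + columnsArea (suc i) (heightsOfD (h + suc i) w)
    ≡⟨ cong (λ k → h + k) (area-levels (suc i) w dyck) ⟩
  h + (sum (levels h w) + triangle h)                                 ≡⟨ sym (+-assoc h _ _) ⟩
  h + sum (levels h w) + triangle h                                   ≡⟨ cong (_+ triangle h) (+-comm h _) ⟩
  sum (levels h w) + h + triangle h                                   ≡⟨ +-assoc (sum (levels h w)) h (triangle h) ⟩
  sum (levels h w) + (h + triangle h)                                 ∎
  where open ≡-Reasoning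

dyckFrom-descend : ∀ {h c} → c ≤ h → ∀ w → dyckFrom h (replicate (h ∸ c) D ++ w) ≡ dyckFrom c w
dyckFrom-descend {h} {c} c≤h w =
  trans (cong (λ k → dyckFrom k (replicate (h ∸ c) D ++ w)) (sym (m∸n+n≡m c≤h))) (go (h ∸ c))
  where
  go : ∀ k → dyckFrom (k + c) (replicate k D ++ w) ≡ dyckFrom c w
  go zero    = refl
  go (suc k) = go k

levels-descend : ∀ {h c} → c ≤ h → ∀ w → levels h (replicate (h ∸ c) D ++ w) ≡ levels c w
levels-descend {h} {c} c≤h w =
  trans (cong (λ k → levels k (replicate (h ∸ c) D ++ w)) (sym (m∸n+n≡m c≤h))) (go (h ∸ c))
  where
  go : ∀ k → levels (k + c) (replicate k D ++ w) ≡ levels c w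
  go zero    = refl
  go (suc k) = go k

unlevels-dyck : ∀ {h cs} → Gradual h cs → T (dyckFrom h (unlevels h cs))
unlevels-dyck {h} [] = bottom h
  where
  bottom : ∀ h → T (dyckFrom h (replicate h D))
  bottom zero    = _
  bottom (suc h) = bottom h
unlevels-dyck {h} (_∷_ {c = c} {cs} c≤h gradual) =
  subst T (sym (trans (dyckFrom-descend c≤h _) (dyckFrom-U c (unlevels (suc c) cs)))) (unlevels-dyck gradual)

levels-unlevels : ∀ {h cs} → Gradual h cs → levels h (unlevels h cs) ≡ cs
levels-unlevels {h} [] = bottom h
  where
  bottom : ∀ h → levels h (replicate h D) ≡ []
  bottom zero    = refl
  bottom (suc h) = bottom h
levels-unlevels {h} (_∷_ {c = c} {cs} c≤h gradual) = begin
  levels h (replicate (h ∸ c) D ++ U ∷ unlevels (suc c) cs) ≡⟨ levels-descend c≤h _ ⟩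
  c ∷ levels (suc c) (unlevels (suc c) cs)                   ≡⟨ cong (c ∷_) (levels-unlevels gradual) ⟩
  c ∷ cs                                                    ∎
  where open ≡-Reasoning

unlevels-suc : ∀ {h cs} → Gradual h cs → unlevels (suc h) cs ≡ D ∷ unlevels h cs
unlevels-suc []                                = refl
unlevels-suc {h} (_∷_ {c = c} {cs} c≤h _) =
  cong (λ k → replicate k D ++ U ∷ unlevels (suc c) cs) (+-∸-assoc 1 c≤h)

unlevels-levels : ∀ {h} w → T (dyckFrom h w) → unlevels h (levels h w) ≡ w
unlevels-levels {zero}  []      _    = refl
unlevels-levels {h}     (U ∷ w) dyck =
  cong₂ (λ k w′ → replicate k D ++ U ∷ w′) (n∸n≡0 h) (unlevels-levels w (subst T (dyckFrom-U h w) dyck))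
unlevels-levels {suc h} (D ∷ w) dyck =
  trans (unlevels-suc (levels-gradual w dyck)) (cong (D ∷_) (unlevels-levels w dyck))

prepend : List Step → List (List Step)
prepend w = (U ∷ w) ∷ (D ∷ w) ∷ []

words-length : ∀ l → All (λ w → length w ≡ l) (words l)
words-length zero    = refl ∷ []
words-length (suc l) = concat⁺ (All-map⁺ (All.map (λ len → cong suc len ∷ cong suc len ∷ []) (words-length l)))

∈-words : ∀ w → w ∈ words (length w)
∈-words []      = here refl
∈-words (U ∷ w) = ∈-concatMap⁺ prepend (Any.map (λ { refl → here refl }) (∈-words w))
∈-words (D ∷ w) = ∈-concatMap⁺ prepend (Any.map (λ { refl → there (here refl) }) (∈-words w))

words-unique : ∀ l → Unique (words l)
words-unique zero    = [] ∷ []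
words-unique (suc l) = extend (words l) (words-unique l)
  where
  distinct : ∀ s {w ws} → All (w ≢_) ws → All ((s ∷ w) ≢_) (concatMap prepend ws)
  distinct s w∉ws = concat⁺ (All-map⁺ (All.map (λ w≢w′ → tail≢ w≢w′ ∷ tail≢ w≢w′ ∷ []) w∉ws))
    where
    tail≢ : ∀ {w w′} {s′} → w ≢ w′ → s ∷ w ≢ s′ ∷ w′
    tail≢ w≢w′ eq = w≢w′ (∷-injectiveʳ eq)

  extend : ∀ ws → Unique ws → Unique (concatMap prepend ws)
  extend []       []            = []
  extend (w ∷ ws) (w∉ws ∷ uniq) = ((λ ()) ∷ distinct U w∉ws) ∷ distinct D w∉ws ∷ extend ws uniq

∈-DyckPaths⁻ : ∀ {m μ} → μ ∈ DyckPaths m → length μ ≡ 2 * m × T (isDyck μ)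
∈-DyckPaths⁻ μ∈ = let μ∈words , dyck = ∈-filter⁻ (λ μ → T? (isDyck μ)) μ∈
                  in  All.lookup (words-length _) μ∈words , dyck

∈-DyckPaths⁺ : ∀ {m μ} → length μ ≡ 2 * m → T (isDyck μ) → μ ∈ DyckPaths m
∈-DyckPaths⁺ {μ = μ} len dyck =
  ∈-filter⁺ (λ μ → T? (isDyck μ)) (subst (λ l → μ ∈ words l) len (∈-words μ)) dyck

DyckPaths-unique : ∀ m → Unique (DyckPaths m)
DyckPaths-unique m = Unique.filter⁺ (λ μ → T? (isDyck μ)) (words-unique (2 * m))

unique-within : ∀ {A : Set} {R : A → A → Set} {xs} →
                (∀ {x y} → x ∈ xs → y ∈ xs → x ≢ y → R x y) → Unique xs → AllPairs R xs
unique-within {xs = []}     _ []              = []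
unique-within {xs = x ∷ xs} r (x∉xs ∷ unique) =
  All.tabulate (λ y∈xs → r (here refl) (there y∈xs) (All.lookup x∉xs y∈xs))
  ∷ unique-within (λ x∈ y∈ → r (there x∈) (there y∈)) unique

length-U∷ : ∀ {w} → T (dyckFrom 1 w) → length (U ∷ w) ≡ 2 * suc (length (levels 1 w))
length-U∷ {w} dyck = trans (cong suc (length-levels w dyck)) (arith (length (levels 1 w)))
  where
  arith : ∀ l → suc (2 * l + 1) ≡ 2 * suc l
  arith = solve-∀

DyckPaths-shape : ∀ {n μ} → μ ∈ DyckPaths (suc n) →
                  ∃ λ w → μ ≡ U ∷ w × T (dyckFrom 1 w) × length (levels 1 w) ≡ n
DyckPaths-shape {n} {μ} μ∈ with ∈-DyckPaths⁻ {suc n} {μ} μ∈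
DyckPaths-shape {μ = U ∷ w} _ | len , dyck =
  w , refl , dyck , suc-injective (*-cancelˡ-≡ _ _ 2 (trans (sym (length-U∷ {w} dyck)) len))

piecesWeight : List Piece → ℤ × ℤ × ℤ
piecesWeight ps =
  let Nd = countᵇ isDimer ps
      Nm = countᵇ isMono ps
  in  (+ (Nd + Nm)) , (+ (2 * Nd + Nm)) , (+ sum (map leftAbs ps))

dyckTriple : ℕ → ℕ → ℕ → ℤ × ℤ × ℤ
dyckTriple n r A = (+ n) , (+ n ℤ.+ (+ suc n ℤ.- + r)) , (+ n ℤ.+ ((+ r ℤ.+ + A) ℤ.- + suc n))

heapOf-weight : ∀ {n} cs → length cs ≡ n → heapWeight (heapOf n (lookupℕ cs)) ≡ piecesWeight (map pieceOf cs)
heapOf-weight cs refl = cong piecesWeight (begin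
  map (λ i → pieceOf (lookupℕ cs (toℕ i))) (allFin (length cs))  ≡⟨ map-tabulate (λ i → i) _ ⟩
  tabulate (λ i → pieceOf (lookupℕ cs (toℕ i)))                 ≡⟨ map-tabulate (λ i → lookupℕ cs (toℕ i)) pieceOf ⟨
  map pieceOf (tabulate (λ i → lookupℕ cs (toℕ i)))             ≡⟨ cong (map pieceOf) (tabulate-lookupℕ cs) ⟩
  map pieceOf cs                                                ∎)
  where open ≡-Reasoning

countᵇ-isMono-pieceOf : ∀ cs → countᵇ isMono (map pieceOf cs) ≡ zeros cs
countᵇ-isMono-pieceOf []           = refl
countᵇ-isMono-pieceOf (zero  ∷ cs) = cong suc (countᵇ-isMono-pieceOf cs)
countᵇ-isMono-pieceOf (suc _ ∷ cs) = countᵇ-isMono-pieceOf cs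

length≡dimers+zeros : ∀ cs → length cs ≡ countᵇ isDimer (map pieceOf cs) + zeros cs
length≡dimers+zeros []           = refl
length≡dimers+zeros (zero  ∷ cs) = trans (cong suc (length≡dimers+zeros cs)) (sym (+-suc _ _))
length≡dimers+zeros (suc _ ∷ cs) = cong suc (length≡dimers+zeros cs)

sum-leftAbs-pieceOf : ∀ cs → sum (map leftAbs (map pieceOf cs)) ≡ sum cs + zeros cs
sum-leftAbs-pieceOf []           = refl
sum-leftAbs-pieceOf (zero  ∷ cs) = trans (cong suc (sum-leftAbs-pieceOf cs)) (sym (+-suc _ _))
sum-leftAbs-pieceOf (suc c ∷ cs) =
  trans (cong (λ k → suc c + k) (sum-leftAbs-pieceOf cs)) (sym (+-assoc (suc c) _ _))

-- Natural-number addition inside +_ computes, so both exponents are instances of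
-- ring identities in the atoms + d, + z and + A.
dyckTriple-split : ∀ d z A → dyckTriple (d + z) (suc z) A ≡ ((+ (d + z)) , (+ (2 * d + z)) , (+ (A + z)))
dyckTriple-split d z A =
  cong (+ (d + z) ,_) (cong₂ _,_ (sym (y-exponent (+ d) (+ z))) (sym (p-exponent (+ d) (+ z) (+ A))))
  where
  y-exponent : ∀ a b → a ℤ.+ (a ℤ.+ + 0) ℤ.+ b ≡ a ℤ.+ b ℤ.+ ((+ 1 ℤ.+ (a ℤ.+ b)) ℤ.- (+ 1 ℤ.+ b))
  y-exponent = ℤ-Solver.solve-∀

  p-exponent : ∀ a b c → c ℤ.+ b ≡ a ℤ.+ b ℤ.+ ((+ 1 ℤ.+ b ℤ.+ c) ℤ.- (+ 1 ℤ.+ (a ℤ.+ b)))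
  p-exponent = ℤ-Solver.solve-∀

weight-pieceOf : ∀ cs → piecesWeight (map pieceOf cs) ≡ dyckTriple (length cs) (suc (zeros cs)) (sum cs)
weight-pieceOf cs = begin
  piecesWeight (map pieceOf cs)                   ≡⟨ cong₂ (λ m s → (+ (d + m)) , (+ (2 * d + m)) , (+ s))
                                                            (countᵇ-isMono-pieceOf cs) (sum-leftAbs-pieceOf cs) ⟩
  (+ (d + z)) , (+ (2 * d + z)) , (+ (sum cs + z)) ≡⟨ dyckTriple-split d z (sum cs) ⟨
  dyckTriple (d + z) (suc z) (sum cs)             ≡⟨ cong (λ l → dyckTriple l (suc z) (sum cs)) (length≡dimers+zeros cs) ⟨
  dyckTriple (length cs) (suc z) (sum cs)         ∎
  where
  open ≡-Reasoning
  d z : ℕ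
  d = countᵇ isDimer (map pieceOf cs)
  z = zeros cs

-- Heaps of Dyck paths

-- The i-th piece of the heap of a Dyck path comes from its (i+2)-th up step:
-- a monomer if that step starts at height 0, the dimer [c, c+1] if at height c ≥ 1.
pathHeap : ∀ n → List Step → Heap n
pathHeap n μ = heapOf n (lookupℕ (drop 1 (levels 0 μ)))

module _ {n : ℕ} where

  pathHeap-admissible : ∀ {μ} → μ ∈ DyckPaths (suc n) → Admissible (pathHeap n μ)
  pathHeap-admissible μ∈ with DyckPaths-shape {n} μ∈
  ... | w , refl , dyck , len =
    heapOf-admissible (subst (λ k → GradualSeq 1 k _) len (gradual⇒gradualSeq (levels-gradual w dyck)))

  pathHeap-weight : ∀ {μ} → μ ∈ DyckPaths (suc n) → heapWeight (pathHeap n μ) ≡ dyckWeight n μ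
  pathHeap-weight μ∈ with DyckPaths-shape {n} μ∈
  ... | w , refl , dyck , len = begin
    heapWeight (heapOf n (lookupℕ cs))                          ≡⟨ heapOf-weight {n} cs len ⟩
    piecesWeight (map pieceOf cs)                               ≡⟨ weight-pieceOf cs ⟩
    dyckTriple (length cs) (suc (zeros cs)) (sum cs)
      ≡⟨ cong₂ (λ l A → dyckTriple l (suc (zeros cs)) A) len (sym (+-identityʳ (sum cs))) ⟩
    dyckTriple n (suc (zeros cs)) (sum cs + 0)
      ≡⟨ cong₂ (dyckTriple n) (returns-levels {1} w dyck) (area-levels {1} 0 w dyck) ⟨
    dyckWeight n (U ∷ w)                                        ∎
    where
    open ≡-Reasoning
    cs : List ℕ
    cs = levels 1 w

  pathHeap-injective : ∀ {μ μ′} → μ ∈ DyckPaths (suc n) → μ′ ∈ DyckPaths (suc n) →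
                       HeapIso (pathHeap n μ) (pathHeap n μ′) → μ ≡ μ′
  pathHeap-injective μ∈ μ′∈ σ with DyckPaths-shape {n} μ∈ | DyckPaths-shape {n} μ′∈
  ... | w , refl , dyck , len | w′ , refl , dyck′ , len′ = cong (U ∷_) (begin
    w                          ≡⟨ unlevels-levels w dyck ⟨
    unlevels 1 (levels 1 w)
      ≡⟨ cong (unlevels 1) (heapOf-injective (levels 1 w) (levels 1 w′) len len′
                                             (slow {w} dyck len) (slow {w′} dyck′ len′) σ) ⟩
    unlevels 1 (levels 1 w′)   ≡⟨ unlevels-levels w′ dyck′ ⟩
    w′                         ∎)
    where
    open ≡-Reasoning
    slow : ∀ {w} → T (dyckFrom 1 w) → length (levels 1 w) ≡ n → SlowRise n (lookupℕ (levels 1 w))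
    slow {w} dyck len = subst (λ k → SlowRise k _) len (proj₂ (gradual⇒gradualSeq (levels-gradual w dyck)))

  admissible-top-code : ∀ {H : Heap n} → Admissible H → (E : LinearExt H) → 0 < n → LinearExt.codeSeq E 0 ≤ 1
  admissible-top-code (_ , inj₁ n≡0) E 0<n = contradiction (sym n≡0) (<⇒≢ 0<n)
  admissible-top-code {H} (_ , inj₂ (m , _ , m-at-1 , unique)) E 0<n =
    subst (_≤ 1) (sym top-code) (leftAbs≡1⇒code≤1 (lab H m) m-at-1)
    where
    open LinearExt E

    t : Fin n
    t = fromℕ< 0<n

    top-code : codeSeq 0 ≡ code (lab H m)
    top-code = begin
      codeSeq 0                ≡⟨ cong codeSeq (toℕ-fromℕ< 0<n) ⟨
      codeSeq (toℕ t)          ≡⟨ codeSeq-toℕ t ⟩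
      code (lab H (elt t))     ≡⟨ cong (λ u → code (lab H u)) (unique (elt t) (top-maximal E t (toℕ-fromℕ< 0<n))) ⟩
      code (lab H m)           ∎
      where open ≡-Reasoning

  pathHeap-surjective : ∀ {H : Heap n} → Admissible H →
                        ∃ λ μ → μ ∈ DyckPaths (suc n) × HeapIso H (pathHeap n μ)
  pathHeap-surjective {H} admissible@(isHeap , _) =
    U ∷ unlevels 1 cs , ∈-DyckPaths⁺ {suc n} length-μ (unlevels-dyck gradual) , iso
    where
    E : LinearExt H
    E = proj₁ (normalExt-exists isHeap)

    open LinearExt E using (length-codes) renaming (codes to cs)

    gradual : Gradual 1 cs
    gradual = gradualSeq⇒gradual cs (subst (λ k → GradualSeq 1 k (lookupℕ cs)) (sym length-codes)
                                            (admissible-top-code admissible E , proj₂ (normalExt-exists isHeap)))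

    length-μ : length (U ∷ unlevels 1 cs) ≡ 2 * suc n
    length-μ = trans (length-U∷ {unlevels 1 cs} (unlevels-dyck gradual))
                     (cong (λ l → 2 * suc l) (trans (cong length (levels-unlevels gradual)) length-codes))

    iso : HeapIso H (pathHeap n (U ∷ unlevels 1 cs))
    iso = subst (λ ds → HeapIso H (heapOf n (lookupℕ ds))) (sym (levels-unlevels gradual)) (linearExt-iso isHeap E)

proposition7p5 : (n : ℕ) →
    Σ (List (Heap n)) λ L →
    All Admissible L ×
    AllPairs (λ H H' → ¬ HeapIso H H') L ×
    ((H : Heap n) → Admissible H → Any (HeapIso H) L) ×
    (map heapWeight L ↭ map (dyckWeight n) (DyckPaths (suc n)))
proposition7p5 n =
    map (pathHeap n) Dyck
  , All-map⁺ (All.tabulate pathHeap-admissible)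
  , AllPairs-map⁺ (unique-within (λ μ∈ μ′∈ μ≢μ′ σ → μ≢μ′ (pathHeap-injective μ∈ μ′∈ σ))
                                 (DyckPaths-unique (suc n)))
  , (λ H admissible → let μ , μ∈ , σ = pathHeap-surjective admissible in Any-map⁺ (lose μ∈ σ))
  , ↭-reflexive (trans (sym (map-∘ Dyck)) (map-cong-local (All.tabulate pathHeap-weight)))
  where
  Dyck : List (List Step)
  Dyck = DyckPaths (suc n)
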